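{- For the Maker-Breaker total domination game, the cycle $C_3$ is ${\cal N}$, the cycle $C_4$ is ${\cal D}$, and the cycles $C_n$ with $n\ge 5$ are ${\cal S}$.
   Context: The Maker-Breaker total domination game on a graph $G$ is played by Dominator and Staller, who alternately select a vertex of $G$ not selected before. Dominator wins if at some point the set of vertices he has selected is a total dominating set of $G$ (every vertex has a neighbour in it); otherwise Staller wins. The D-game is the game where Dominator moves first, the S-game where Staller moves first. A graph is ${\cal D}$ if Dominator has a winning strategy in both games, ${\cal S}$ if Staller has a winning strategy in both, and ${\cal N}$ if the first player has a winning strategy (Dominator wins the D-game and Staller wins the S-game). -}

module Defs where

open import Data.Nat using (ℕ; zero; suc; _+_)
open import Data.Fin using (Fin; toℕ)
open import Data.Fin.Subset using (Subset; _∈_; _∉_; ⁅_⁆; _∪_)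
open import Data.Product using (Σ; _×_; ∃; ∃-syntax)
open import Data.Sum using (_⊎_)
open import Relation.Binary.PropositionalEquality using (_≡_)
open import Relation.Nullary using (¬_)

-- A graph on the vertex set Fin n is given by its (symmetric, irreflexive)
-- adjacency relation.
AdjRel : ℕ → Set₁
AdjRel n = Fin n → Fin n → Set

TotDom : ∀ {n} → AdjRel n → Subset n → Set
TotDom {n} Adj X = ∀ (v : Fin n) → ∃[ u ] (Adj v u × u ∈ X)

Free : ∀ {n} → Subset n → Subset n → Fin n → Set
Free D S v = v ∉ D × v ∉ S

data Player : Set where
  Dominator Staller : Player

-- Game position: Dominator's selected set D, Staller's selected set S,
-- and the player to move.
-- DomWins Adj D S p : Dominator has a winning strategy from this position.
data DomWins {n} (Adj : AdjRel n) : Subset n → Subset n → Player → Set where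
  won   : ∀ {D S p} → TotDom Adj D → DomWins Adj D S p
  dmove : ∀ {D S} (v : Fin n) → Free D S v →
          DomWins Adj (D ∪ ⁅ v ⁆) S Staller → DomWins Adj D S Dominator
  smove : ∀ {D S} → (∃[ v ] Free D S v) →
          (∀ v → Free D S v → DomWins Adj D (S ∪ ⁅ v ⁆) Dominator) →
          DomWins Adj D S Staller

-- StaWins Adj D S p : Staller has a winning strategy from this position,
-- i.e. she can ensure that Dominator's set never becomes totally dominating
-- (until all vertices are selected).
data StaWins {n} (Adj : AdjRel n) : Subset n → Subset n → Player → Set where
  over  : ∀ {D S p} → ¬ TotDom Adj D → (∀ v → ¬ Free D S v) → StaWins Adj D S p
  smove : ∀ {D S} → ¬ TotDom Adj D → (v : Fin n) → Free D S v →
          StaWins Adj D (S ∪ ⁅ v ⁆) Dominator → StaWins Adj D S Staller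
  dmove : ∀ {D S} → ¬ TotDom Adj D →
          (∀ v → Free D S v → StaWins Adj (D ∪ ⁅ v ⁆) S Staller) →
          StaWins Adj D S Dominator

open import Data.Fin.Subset using (⊥)

Dclass Sclass Nclass : ∀ {n} → AdjRel n → Set
Dclass Adj = DomWins Adj ⊥ ⊥ Dominator × DomWins Adj ⊥ ⊥ Staller
Sclass Adj = StaWins Adj ⊥ ⊥ Dominator × StaWins Adj ⊥ ⊥ Staller
Nclass Adj = DomWins Adj ⊥ ⊥ Dominator × StaWins Adj ⊥ ⊥ Staller

-- The cycle C_n on vertices 0,…,n-1 (meaningful for n ≥ 3):
-- i ~ j iff j = i+1, i = j+1, or {i,j} = {0, n-1}.
Cycle : (n : ℕ) → AdjRel n
Cycle n i j = (suc (toℕ i) ≡ toℕ j) ⊎ (suc (toℕ j) ≡ toℕ i)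
            ⊎ (toℕ i ≡ 0 × suc (toℕ j) ≡ n) ⊎ (toℕ j ≡ 0 × suc (toℕ i) ≡ n)

-- For n ≥ 5 Staller plays on forks: a vertex x with two neighbours w₁, w₂ whose
-- only other neighbours y₁, y₂ are distinct from each other and from x (on the cycle,
-- x = i, wⱼ = i ± 1, yⱼ = i ± 2). Once Staller owns x, Dominator cannot claim both
-- y₁ and y₂; Staller takes the remaining one, and then the wⱼ whose neighbourhood she
-- owns can never be totally dominated. In the S-game she opens on any fork; in the
-- D-game she answers Dominator's first vertex with a fork avoiding it, and for n ≥ 5
-- one of the forks centred at 0, 1, −1 always does. The cycles C₃ and C₄ are settled
-- by exhaustive search of the game tree.
module Submission where

open import Defs
open import Data.Nat using (ℕ; zero; suc; _+_; _∸_; _≤_; _<_; z≤n; s≤s)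
open import Data.Nat.Properties
  using (suc-injective; 1+n≢n; m≢1+n+m; <⇒≢; ≤-refl; n≤1+n; m≤n⇒m≤1+n; m+[n∸m]≡n)
  renaming (_≟_ to _≟ℕ_)
open import Data.Fin using (Fin; toℕ; fromℕ<) renaming (zero to fzero; suc to fsuc)
open import Data.Fin.Properties using (toℕ<n; toℕ-fromℕ<; toℕ-injective; any?; all?) renaming (_≟_ to _≟F_)
open import Data.Fin.Subset using (Subset; _∈_; _∉_; _⊂_; _⊃_; ⁅_⁆; _∪_; ⊥)
open import Data.Fin.Subset.Properties
  using (_∈?_; ∉⊥; x∈⁅x⁆; x∈p∪q⁻; x∈p∪q⁺; x∈⁅y⁆⇒x≡y; p⊆p∪q; ∪-assoc; ∪-comm)
open import Data.Fin.Subset.Induction using (Acc; acc; ⊃-wellFounded)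
open import Data.Maybe using (Maybe; just; nothing; map; ap; zip; _<∣>_; from-just)
open import Data.Product using (Σ-syntax; ∃; _×_; _,_; proj₁; proj₂)
open import Data.Sum using (_⊎_; inj₁; inj₂; swap)
open import Function using (_∘_; const)
open import Relation.Binary.PropositionalEquality
  using (_≡_; _≢_; refl; sym; trans; cong; subst; ≢-sym; module ≡-Reasoning)
open import Relation.Nullary using (¬_; Dec; yes; no; contradiction)
open import Relation.Nullary.Decidable using (dec⇒maybe; _×-dec_; _⊎-dec_; ¬?)

private
  variable
    n : ℕ
    D S : Subset n
    v w x y : Fin n

x∉p∪⁅y⁆ : x ∉ D → x ≢ y → x ∉ D ∪ ⁅ y ⁆
x∉p∪⁅y⁆ {D = D} x∉D x≢y x∈ with x∈p∪q⁻ D _ x∈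
... | inj₁ x∈D = x∉D x∈D
... | inj₂ x∈⁅y⁆ = x≢y (x∈⁅y⁆⇒x≡y _ x∈⁅y⁆)

x∈p⇒x∈p∪⁅y⁆ : x ∈ D → x ∈ D ∪ ⁅ y ⁆
x∈p⇒x∈p∪⁅y⁆ x∈D = x∈p∪q⁺ (inj₁ x∈D)

x∈p∪⁅x⁆ : x ∈ D ∪ ⁅ x ⁆
x∈p∪⁅x⁆ {x = x} = x∈p∪q⁺ (inj₂ (x∈⁅x⁆ x))

p⊂p∪⁅x⁆ : x ∉ D → D ⊂ D ∪ ⁅ x ⁆
p⊂p∪⁅x⁆ {x = x} x∉D = p⊆p∪q ⁅ x ⁆ , x , x∈p∪⁅x⁆ , x∉D

free-dmove : Free D S x → x ≢ v → Free (D ∪ ⁅ v ⁆) S x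
free-dmove (x∉D , x∉S) x≢v = x∉p∪⁅y⁆ x∉D x≢v , x∉S

free-smove : Free D S x → x ≢ v → Free D (S ∪ ⁅ v ⁆) x
free-smove (x∉D , x∉S) x≢v = x∉D , x∉p∪⁅y⁆ x∉S x≢v

free⇒∉∪ : Free D S v → v ∉ D ∪ S
free⇒∉∪ {D = D} {S = S} (v∉D , v∉S) v∈ with x∈p∪q⁻ D S v∈
... | inj₁ v∈D = v∉D v∈D
... | inj₂ v∈S = v∉S v∈S

free? : ∀ (D S : Subset n) v → Dec (Free D S v)
free? D S v = ¬? (v ∈? D) ×-dec ¬? (v ∈? S)

∈⇒≢free : x ∈ S → Free D S v → x ≢ v
∈⇒≢free x∈S (_ , v∉S) refl = v∉S x∈S

smove-grows : Free D S v → (D ∪ (S ∪ ⁅ v ⁆)) ⊃ (D ∪ S)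
smove-grows {D = D} {S = S} {v = v} free =
  subst (_⊃ (D ∪ S)) (∪-assoc D S ⁅ v ⁆) (p⊂p∪⁅x⁆ (free⇒∉∪ free))

dmove-grows : Free D S v → ((D ∪ ⁅ v ⁆) ∪ S) ⊃ (D ∪ S)
dmove-grows {D = D} {S = S} {v = v} free =
  subst (_⊃ (D ∪ S)) (sym selected) (p⊂p∪⁅x⁆ (free⇒∉∪ free))
  where
  open ≡-Reasoning
  selected : (D ∪ ⁅ v ⁆) ∪ S ≡ (D ∪ S) ∪ ⁅ v ⁆
  selected = begin
    (D ∪ ⁅ v ⁆) ∪ S  ≡⟨ ∪-assoc D ⁅ v ⁆ S ⟩
    D ∪ (⁅ v ⁆ ∪ S)  ≡⟨ cong (D ∪_) (∪-comm ⁅ v ⁆ S) ⟩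
    D ∪ (S ∪ ⁅ v ⁆)  ≡⟨ ∪-assoc D S ⁅ v ⁆ ⟨
    (D ∪ S) ∪ ⁅ v ⁆  ∎

module Strategies (Adj : AdjRel n) where

  Neighbours : Fin n → Fin n → Fin n → Set
  Neighbours w x y = ∀ {u} → Adj w u → u ≡ x ⊎ u ≡ y

  Isolated : Subset n → Subset n → Fin n → Set
  Isolated D S w = ∀ {u} → Adj w u → u ∈ S × u ∉ D

  neighbours-sym : Neighbours w x y → Neighbours w y x
  neighbours-sym nbrs w~u = swap (nbrs w~u)

  neighbours∉⇒¬TotDom : Neighbours w x y → x ∉ D → y ∉ D → ¬ TotDom Adj D
  neighbours∉⇒¬TotDom {w = w} nbrs x∉D y∉D td with td w
  ... | u , w~u , u∈D with nbrs w~u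
  ... | inj₁ refl = x∉D u∈D
  ... | inj₂ refl = y∉D u∈D

  isolated⇒¬TotDom : Isolated D S w → ¬ TotDom Adj D
  isolated⇒¬TotDom {w = w} iso td with td w
  ... | u , w~u , u∈D = proj₂ (iso w~u) u∈D

  isolated-dmove : Isolated D S w → v ∉ S → Isolated (D ∪ ⁅ v ⁆) S w
  isolated-dmove iso v∉S w~u with iso w~u
  ... | u∈S , u∉D = u∈S , x∉p∪⁅y⁆ u∉D λ { refl → v∉S u∈S }

  isolated-smove : Isolated D S w → Isolated D (S ∪ ⁅ v ⁆) w
  isolated-smove iso w~u with iso w~u
  ... | u∈S , u∉D = x∈p⇒x∈p∪⁅y⁆ u∈S , u∉D

  -- Staller simply fills the board; the selected set grows, which gives termination.
  isolated⇒staWins : ∀ p → Isolated D S w → StaWins Adj D S p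
  isolated⇒staWins p = play p (⊃-wellFounded _)
    where
    play : ∀ {D S} p → Acc _⊃_ (D ∪ S) → Isolated D S w → StaWins Adj D S p
    play {D = D} {S = S} Staller (acc more) iso with any? (free? D S)
    ... | no full = over (isolated⇒¬TotDom iso) λ v free → full (v , free)
    ... | yes (v , free) = smove (isolated⇒¬TotDom iso) v free
      (play Dominator (more (smove-grows free)) (isolated-smove iso))
    play Dominator (acc more) iso = dmove (isolated⇒¬TotDom iso) λ v free →
      play Staller (more (dmove-grows free)) (isolated-dmove iso (proj₂ free))

  threat⇒staWins : Neighbours w x y → x ∈ S → x ∉ D → Free D S y → StaWins Adj D S Staller
  threat⇒staWins {w = w} {y = y} {S = S} {D = D} nbrs x∈S x∉D y-free =
    smove (isolated⇒¬TotDom iso) y y-free (isolated⇒staWins Dominator iso)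
    where
    iso : Isolated D (S ∪ ⁅ y ⁆) w
    iso w~u with nbrs w~u
    ... | inj₁ refl = x∈p⇒x∈p∪⁅y⁆ x∈S , x∉D
    ... | inj₂ refl = x∈p∪⁅x⁆ , proj₁ y-free

  doubleThreat⇒staWins : ∀ {w₁ w₂ y₁ y₂} → Neighbours w₁ x y₁ → Neighbours w₂ x y₂ →
                         x ∈ S → x ∉ D → Free D S y₁ → Free D S y₂ → y₁ ≢ y₂ →
                         StaWins Adj D S Dominator
  doubleThreat⇒staWins {S = S} {D = D} {y₁ = y₁} nbrs₁ nbrs₂ x∈S x∉D y₁-free y₂-free y₁≢y₂ =
    dmove (neighbours∉⇒¬TotDom nbrs₁ x∉D (proj₁ y₁-free)) respond
    where
    respond : ∀ v → Free D S v → StaWins Adj (D ∪ ⁅ v ⁆) S Staller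
    respond v v-free with v ≟F y₁
    ... | yes refl = threat⇒staWins nbrs₂ x∈S (x∉p∪⁅y⁆ x∉D (∈⇒≢free x∈S v-free))
                       (free-dmove y₂-free (≢-sym y₁≢y₂))
    ... | no v≢y₁ = threat⇒staWins nbrs₁ x∈S (x∉p∪⁅y⁆ x∉D (∈⇒≢free x∈S v-free))
                      (free-dmove y₁-free (≢-sym v≢y₁))

  record Fork : Set where
    field
      centre w₁ y₁ w₂ y₂ : Fin n
      w₁-neighbours : Neighbours w₁ centre y₁
      w₂-neighbours : Neighbours w₂ centre y₂
      y₁≢y₂ : y₁ ≢ y₂
      centre≢y₁ : centre ≢ y₁
      centre≢y₂ : centre ≢ y₂

  Avoids : Fork → Fin n → Set
  Avoids f a = centre ≢ a × y₁ ≢ a × y₂ ≢ a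
    where open Fork f

  fork⇒staWins : (f : Fork) → let open Fork f in
                 Free D S centre → Free D S y₁ → Free D S y₂ → StaWins Adj D S Staller
  fork⇒staWins f x-free y₁-free y₂-free =
    smove (neighbours∉⇒¬TotDom w₁-neighbours (proj₁ x-free) (proj₁ y₁-free)) centre x-free
      (doubleThreat⇒staWins w₁-neighbours w₂-neighbours x∈p∪⁅x⁆ (proj₁ x-free)
        (free-smove y₁-free (≢-sym centre≢y₁)) (free-smove y₂-free (≢-sym centre≢y₂)) y₁≢y₂)
    where open Fork f

  forks⇒Sclass : Fork → (∀ a → Σ[ f ∈ Fork ] Avoids f a) → Sclass Adj
  forks⇒Sclass f avoiding = dgame , fork⇒staWins f (∉⊥ , ∉⊥) (∉⊥ , ∉⊥) (∉⊥ , ∉⊥)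
    where
    open Fork f using (w₁-neighbours)
    dgame : StaWins Adj ⊥ ⊥ Dominator
    dgame = dmove (neighbours∉⇒¬TotDom w₁-neighbours ∉⊥ ∉⊥) λ a _ →
      let (g , x≢a , y₁≢a , y₂≢a) = avoiding a
      in fork⇒staWins g (free-dmove (∉⊥ , ∉⊥) x≢a) (free-dmove (∉⊥ , ∉⊥) y₁≢a)
                        (free-dmove (∉⊥ , ∉⊥) y₂≢a)

any-just : {P : Fin n → Set} → (∀ v → Maybe (P v)) → Maybe (∃ P)
any-just {zero} f = nothing
any-just {suc n} f = map (fzero ,_) (f fzero) <∣> map (λ (v , p) → fsuc v , p) (any-just (f ∘ fsuc))

all-just : {P : Fin n → Set} → (∀ v → Maybe (P v)) → Maybe (∀ v → P v)
all-just {zero} f = just λ ()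
all-just {suc n} {P} f = ap (map cons (f fzero)) (all-just {P = P ∘ fsuc} (f ∘ fsuc))
  where
  cons : P fzero → (∀ v → P (fsuc v)) → ∀ v → P v
  cons p ps fzero = p
  cons p ps (fsuc v) = ps v

module Search (Adj : AdjRel n) (adj? : ∀ i j → Dec (Adj i j)) where

  totDom? : ∀ X → Dec (TotDom Adj X)
  totDom? X = all? λ v → any? λ u → adj? v u ×-dec (u ∈? X)

  assuming : {A B : Set} → Dec A → Maybe B → Maybe (A → B)
  assuming (yes _) b = map const b
  assuming (no ¬a) _ = just λ a → contradiction a ¬a

  -- Search of the game tree up to depth k; `nothing` only means the search gave up.
  domWins? : ℕ → ∀ D S p → Maybe (DomWins Adj D S p)
  domWins? k D S p with totDom? D
  domWins? k D S p | yes td = just (won td)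
  domWins? zero D S p | no _ = nothing
  domWins? (suc k) D S Dominator | no _ =
    map (λ (v , free , win) → dmove v free win)
      (any-just λ v → zip (dec⇒maybe (free? D S v)) (domWins? k (D ∪ ⁅ v ⁆) S Staller))
  domWins? (suc k) D S Staller | no _ =
    ap (map smove (any-just (dec⇒maybe ∘ free? D S)))
      (all-just λ v → assuming (free? D S v) (domWins? k D (S ∪ ⁅ v ⁆) Dominator))

  staWins? : ℕ → ∀ D S p → Maybe (StaWins Adj D S p)
  staWins? k D S p with totDom? D
  staWins? k D S p | yes _ = nothing
  staWins? k D S p | no ¬td with all? (¬? ∘ free? D S)
  staWins? k D S p | no ¬td | yes full = just (over ¬td full)
  staWins? zero D S p | no _ | no _ = nothing
  staWins? (suc k) D S Staller | no ¬td | no _ =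
    map (λ (v , free , win) → smove ¬td v free win)
      (any-just λ v → zip (dec⇒maybe (free? D S v)) (staWins? k D (S ∪ ⁅ v ⁆) Dominator))
  staWins? (suc k) D S Dominator | no ¬td | no _ =
    map (dmove ¬td) (all-just λ v → assuming (free? D S v) (staWins? k (D ∪ ⁅ v ⁆) S Staller))

cycle? : ∀ n i j → Dec (Cycle n i j)
cycle? n i j = (suc (toℕ i) ≟ℕ toℕ j) ⊎-dec (suc (toℕ j) ≟ℕ toℕ i)
  ⊎-dec ((toℕ i ≟ℕ 0) ×-dec (suc (toℕ j) ≟ℕ n))
  ⊎-dec ((toℕ j ≟ℕ 0) ×-dec (suc (toℕ i) ≟ℕ n))

cycle₃-N : Nclass (Cycle 3)
cycle₃-N = from-just (domWins? 3 ⊥ ⊥ Dominator) , from-just (staWins? 3 ⊥ ⊥ Staller)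
  where open Search (Cycle 3) (cycle? 3)

cycle₄-D : Dclass (Cycle 4)
cycle₄-D = from-just (domWins? 4 ⊥ ⊥ Dominator) , from-just (domWins? 4 ⊥ ⊥ Staller)
  where open Search (Cycle 4) (cycle? 4)

cycle-inner : ∀ {i} {w u : Fin n} → toℕ w ≡ suc i → suc (suc i) < n → Cycle n w u →
              toℕ u ≡ i ⊎ toℕ u ≡ suc (suc i)
cycle-inner w≡ _ (inj₁ e) = inj₂ (trans (sym e) (cong suc w≡))
cycle-inner w≡ _ (inj₂ (inj₁ e)) = inj₁ (suc-injective (trans e w≡))
cycle-inner w≡ _ (inj₂ (inj₂ (inj₁ (w≡0 , _)))) = contradiction (trans (sym w≡) w≡0) λ ()
cycle-inner w≡ i<n (inj₂ (inj₂ (inj₂ (_ , e)))) = contradiction (trans (cong suc (sym w≡)) e) (<⇒≢ i<n)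

cycle-first : ∀ {w u : Fin (suc n)} → toℕ w ≡ 0 → Cycle (suc n) w u → toℕ u ≡ 1 ⊎ toℕ u ≡ n
cycle-first w≡ (inj₁ e) = inj₁ (trans (sym e) (cong suc w≡))
cycle-first w≡ (inj₂ (inj₁ e)) = contradiction (trans e w≡) λ ()
cycle-first w≡ (inj₂ (inj₂ (inj₁ (_ , e)))) = inj₂ (suc-injective e)
cycle-first w≡ (inj₂ (inj₂ (inj₂ (u≡0 , e)))) = inj₂ (trans u≡0 (trans (sym w≡) (suc-injective e)))

cycle-last : ∀ {w u : Fin (suc (suc n))} → toℕ w ≡ suc n → Cycle (suc (suc n)) w u →
             toℕ u ≡ 0 ⊎ toℕ u ≡ n
cycle-last {u = u} w≡ (inj₁ e) = contradiction (trans (cong suc (sym w≡)) e) (<⇒≢ (toℕ<n u) ∘ sym)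
cycle-last w≡ (inj₂ (inj₁ e)) = inj₂ (suc-injective (trans e w≡))
cycle-last w≡ (inj₂ (inj₂ (inj₁ (w≡0 , _)))) = contradiction (trans (sym w≡) w≡0) λ ()
cycle-last w≡ (inj₂ (inj₂ (inj₂ (u≡0 , _)))) = inj₁ u≡0

module LongCycle (m : ℕ) where

  open Strategies (Cycle (5 + m))

  opaque
    vertex : ∀ k → k ≤ 4 + m → Fin (5 + m)
    vertex k k≤ = fromℕ< (s≤s k≤)

    toℕ-vertex : ∀ {k} (k≤ : k ≤ 4 + m) → toℕ (vertex k k≤) ≡ k
    toℕ-vertex k≤ = toℕ-fromℕ< (s≤s k≤)

  vertex≢ : ∀ {k l a} {k≤ : k ≤ 4 + m} → toℕ a ≡ l → k ≢ l → vertex k k≤ ≢ a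
  vertex≢ {k≤ = k≤} a≡l k≢l refl = k≢l (trans (sym (toℕ-vertex k≤)) a≡l)

  vertex≢vertex : ∀ {k l} {k≤ : k ≤ 4 + m} {l≤ : l ≤ 4 + m} → k ≢ l → vertex k k≤ ≢ vertex l l≤
  vertex≢vertex {l≤ = l≤} = vertex≢ (toℕ-vertex l≤)

  neighbours-by-label : ∀ {w k l} (k≤ : k ≤ 4 + m) (l≤ : l ≤ 4 + m) →
                        (∀ {u} → Cycle (5 + m) w u → toℕ u ≡ k ⊎ toℕ u ≡ l) →
                        Neighbours w (vertex k k≤) (vertex l l≤)
  neighbours-by-label k≤ l≤ labels w~u with labels w~u
  ... | inj₁ e = inj₁ (toℕ-injective (trans e (sym (toℕ-vertex k≤))))
  ... | inj₂ e = inj₂ (toℕ-injective (trans e (sym (toℕ-vertex l≤))))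

  -- Labels are read modulo 5 + m: v₋ₖ is the vertex 5 + m − k.
  v₀ v₁ v₂ v₃ v₋₃ v₋₂ v₋₁ : Fin (5 + m)
  v₀ = vertex 0 z≤n
  v₁ = vertex 1 (s≤s z≤n)
  v₂ = vertex 2 (s≤s (s≤s z≤n))
  v₃ = vertex 3 (s≤s (s≤s (s≤s z≤n)))
  v₋₃ = vertex (2 + m) (m≤n⇒m≤1+n (n≤1+n _))
  v₋₂ = vertex (3 + m) (n≤1+n _)
  v₋₁ = vertex (4 + m) ≤-refl

  neighbours₀ : Neighbours v₀ v₁ v₋₁
  neighbours₀ = neighbours-by-label _ _ (cycle-first (toℕ-vertex _))

  neighbours₁ : Neighbours v₁ v₀ v₂
  neighbours₁ = neighbours-by-label _ _ (cycle-inner (toℕ-vertex _) (s≤s (s≤s (s≤s z≤n))))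

  neighbours₂ : Neighbours v₂ v₁ v₃
  neighbours₂ = neighbours-by-label _ _ (cycle-inner (toℕ-vertex _) (s≤s (s≤s (s≤s (s≤s z≤n)))))

  neighbours₋₂ : Neighbours v₋₂ v₋₁ v₋₃
  neighbours₋₂ = neighbours-by-label _ _ (swap ∘ cycle-inner (toℕ-vertex _) ≤-refl)

  neighbours₋₁ : Neighbours v₋₁ v₀ v₋₂
  neighbours₋₁ = neighbours-by-label _ _ (cycle-last (toℕ-vertex _))

  fork₀ fork₁ fork₋₁ : Fork
  fork₀ = record
    { centre = v₀ ; w₁ = v₁ ; y₁ = v₂ ; w₂ = v₋₁ ; y₂ = v₋₂
    ; w₁-neighbours = neighbours₁ ; w₂-neighbours = neighbours₋₁
    ; y₁≢y₂ = vertex≢vertex λ () ; centre≢y₁ = vertex≢vertex λ ()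
    ; centre≢y₂ = vertex≢vertex λ () }
  fork₁ = record
    { centre = v₁ ; w₁ = v₂ ; y₁ = v₃ ; w₂ = v₀ ; y₂ = v₋₁
    ; w₁-neighbours = neighbours₂ ; w₂-neighbours = neighbours₀
    ; y₁≢y₂ = vertex≢vertex λ () ; centre≢y₁ = vertex≢vertex λ ()
    ; centre≢y₂ = vertex≢vertex λ () }
  fork₋₁ = record
    { centre = v₋₁ ; w₁ = v₀ ; y₁ = v₁ ; w₂ = v₋₂ ; y₂ = v₋₃
    ; w₁-neighbours = neighbours-sym neighbours₀ ; w₂-neighbours = neighbours₋₂
    ; y₁≢y₂ = vertex≢vertex λ () ; centre≢y₁ = vertex≢vertex λ ()
    ; centre≢y₂ = vertex≢vertex (≢-sym (m≢1+n+m (2 + m) {1})) }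

  fork-avoiding : ∀ a → Σ[ f ∈ Fork ] Avoids f a
  fork-avoiding a with toℕ a in a≡
  ... | 0 = fork₁ , vertex≢ a≡ (λ ()) , vertex≢ a≡ (λ ()) , vertex≢ a≡ (λ ())
  ... | 1 = fork₀ , vertex≢ a≡ (λ ()) , vertex≢ a≡ (λ ()) , vertex≢ a≡ (λ ())
  ... | 2 = fork₁ , vertex≢ a≡ (λ ()) , vertex≢ a≡ (λ ()) , vertex≢ a≡ (λ ())
  ... | suc (suc (suc j)) with j ≟ℕ m
  ...   | yes refl = fork₋₁ , vertex≢ a≡ 1+n≢n , vertex≢ a≡ (λ ()) , vertex≢ a≡ (1+n≢n ∘ sym)
  ...   | no j≢m = fork₀ , vertex≢ a≡ (λ ()) , vertex≢ a≡ (λ ())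
                         , vertex≢ a≡ (j≢m ∘ sym ∘ suc-injective ∘ suc-injective ∘ suc-injective)

  cycle-S : Sclass (Cycle (5 + m))
  cycle-S = forks⇒Sclass fork₀ fork-avoiding

proposition2p4 : Nclass (Cycle 3) × Dclass (Cycle 4)
                 × (∀ (n : ℕ) → 5 ≤ n → Sclass (Cycle n))
proposition2p4 = cycle₃-N , cycle₄-D , λ n 5≤n →
  subst (λ k → Sclass (Cycle k)) (m+[n∸m]≡n 5≤n) (LongCycle.cycle-S (n ∸ 5))
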